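{- Let $n \ge 2$ be an integer. There exists a set $\mathcal{G}$ of (non-oriented, loopless) graphs on the vertex set $[n]$, containing at least half of all such graphs, such that no two distinct graphs $G_1, G_2 \in \mathcal{G}$ have edge sets $E(G_1), E(G_2)$ with $E(G_1)\,\Delta\, E(G_2) = \{\{x,y\} : x,y \in I,\ x \ne y\}$ for some interval $I \subset [n]$ (that is, the symmetric difference of the edge sets is never the edge set of a clique whose vertex set is an interval).
   Context: $[n]=\{1,\dots,n\}$; for integers $a \le b$, $[a,b]=\{a,a+1,\dots,b\}$ is called an interval. $\Delta$ denotes symmetric difference. -}

module Defs where

open import Data.Nat using (ℕ; _≤_; _≤?_)
open import Data.Fin using (Fin; toℕ)
open import Data.Bool using (Bool; false; _xor_; _∧_)
open import Data.Product using (∃-syntax; _×_)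
open import Relation.Binary.PropositionalEquality using (_≡_; _≢_)
open import Relation.Nullary using (¬_; does)

-- A (non-oriented, loopless) graph on the vertex set [n], represented by
-- Fin n (vertex i ∈ Fin n stands for i+1 ∈ [n]), given by a symmetric,
-- irreflexive Boolean adjacency function: {x,y} is an edge iff adj x y = true.
record Graph (n : ℕ) : Set where
  field
    adj    : Fin n → Fin n → Bool
    sym    : ∀ i j → adj i j ≡ adj j i
    irrefl : ∀ i → adj i i ≡ false
open Graph public

Distinct : ∀ {n} → Graph n → Graph n → Set
Distinct G₁ G₂ = ∃[ i ] ∃[ j ] adj G₁ i j ≢ adj G₂ i j

inInterval : ∀ {n} → Fin n → Fin n → Fin n → Bool
inInterval a b x = does (toℕ a ≤? toℕ x) ∧ does (toℕ x ≤? toℕ b)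

SymDiffIsIntervalClique : ∀ {n} → Graph n → Graph n → Set
SymDiffIsIntervalClique {n} G₁ G₂ =
  ∃[ a ] ∃[ b ] (toℕ {n} a ≤ toℕ b) ×
    (∀ x y → x ≢ y →
      (adj G₁ x y xor adj G₂ x y) ≡ (inInterval a b x ∧ inInterval a b y))

-- Let π(G) be the parity of the number of edges of G of the form {x, x+1} or {x, x+2}.
-- π is additive over symmetric differences, and the clique on an interval of k ≥ 2
-- vertices has (k − 1) + (k − 2) such edges, an odd number, while a one-vertex interval
-- gives no edges at all. Hence two distinct graphs with the same π never differ by an
-- interval clique, and the graphs with even π form half of all graphs, since toggling
-- the edge {1, 2} flips π.

module Submission where

open import Defs
open import Algebra.Bundles using (CommutativeRing)
open import Data.Bool using (Bool; true; false; _xor_; _∧_; T)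
open import Data.Bool.Properties
  using (xor-same; xor-identityʳ; xor-∧-commutativeRing; ¬-not; T-∧)
  renaming (_≟_ to _≟ᵇ_)
open import Data.Fin using (Fin; toℕ) renaming (zero to fz; suc to fs)
open import Data.Fin.Properties using (toℕ-injective; toℕ<n; suc-injective; ¬∀⟶∃¬; all?)
  renaming (_≟_ to _≟ᶠ_)
open import Data.List
  using (List; []; _∷_; length; map; _++_; cartesianProductWith; cartesianProduct)
open import Data.List.Properties using (length-map; length-++)
open import Data.List.Relation.Unary.All using ([]; _∷_)
open import Data.List.Relation.Unary.AllPairs using (AllPairs; []; _∷_)
import Data.List.Relation.Unary.AllPairs as AllPairs
import Data.List.Relation.Unary.AllPairs.Properties as AllPairs
open import Data.List.Relation.Unary.Unique.Propositional using (Unique)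
import Data.List.Relation.Unary.Unique.Propositional.Properties as Unique
open import Data.Nat
  using (ℕ; zero; suc; pred; _+_; _*_; _^_; _≤_; _<_; _≤ᵇ_; _<ᵇ_; _≤?_; z≤n; s≤s)
open import Data.Nat.Combinatorics using (_C_; nC1≡n; nCk+nC[k+1]≡[n+1]C[k+1])
open import Data.Nat.Properties
  using ( ≤ᵇ⇒≤; <⇒<ᵇ; ≮⇒≥; ≤-antisym; ≤-trans; ≤-reflexive
        ; *-comm; *-assoc; ^-distribˡ-+-*)
open import Data.Product using (Σ; _×_; _,_)
open import Data.Unit using (⊤; tt)
open import Data.Vec using (Vec; []; _∷_; lookup)
open import Data.Vec.Properties using (∷-injective; tabulate-cong; tabulate∘lookup)
open import Function using (_∘_)
open import Function.Bundles using (Equivalence)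
open import Relation.Binary.PropositionalEquality as ≡
  using (_≡_; _≢_; refl; trans; cong; cong₂; subst; module ≡-Reasoning)
open import Relation.Nullary using (¬_; yes; no; does)

open import Algebra.Properties.CommutativeSemigroup
  (CommutativeRing.+-commutativeSemigroup xor-∧-commutativeRing)
  using (interchange; x∙yz≈y∙xz)

xor-interchange : ∀ a b c d → (a xor b) xor (c xor d) ≡ (a xor c) xor (b xor d)
xor-interchange = interchange

xor≡false⇒≡ : ∀ {x y} → x xor y ≡ false → x ≡ y
xor≡false⇒≡ {false} {false} _ = refl
xor≡false⇒≡ {true}  {true}  _ = refl

<ᵇ-suc : ∀ m n → (m <ᵇ suc n) ≡ (m ≤ᵇ n)
<ᵇ-suc zero    n = refl
<ᵇ-suc (suc m) n = refl

inRange : ℕ → ℕ → ℕ → Bool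
inRange a b x = does (a ≤? x) ∧ does (x ≤? b)

inRange-suc : ∀ a b x → inRange a (suc b) (suc x) ≡ inRange (pred a) b x
inRange-suc zero    b x = <ᵇ-suc x b
inRange-suc (suc a) b x = cong₂ _∧_ (<ᵇ-suc a x) (<ᵇ-suc x b)

inRange⇒bounds : ∀ {a b x} → T (inRange a b x) → a ≤ x × x ≤ b
inRange⇒bounds {a} {b} {x} t with Equivalence.to T-∧ t
... | a≤x , x≤b = ≤ᵇ⇒≤ a x a≤x , ≤ᵇ⇒≤ x b x≤b

-- Definitionally inInterval a b x ∧ inInterval a b y once the endpoints are read as
-- numbers, which lets them be shifted past vertex 0.
intervalClique : ∀ {n} → ℕ → ℕ → Fin n → Fin n → Bool
intervalClique a b x y = inRange a b (toℕ x) ∧ inRange a b (toℕ y)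

intervalClique-suc : ∀ {n} a b (x y : Fin n) →
  intervalClique a (suc b) (fs x) (fs y) ≡ intervalClique (pred a) b x y
intervalClique-suc a b x y = cong₂ _∧_ (inRange-suc a b (toℕ x)) (inRange-suc a b (toℕ y))

intervalClique-edgeless : ∀ {n a b} {x y : Fin n} → b ≤ a → x ≢ y →
  intervalClique a b x y ≡ false
intervalClique-edgeless {a = a} {b} {x} {y} b≤a x≢y = ¬-not (x≢y ∘ bothInRange⇒≡)
  where
  bothInRange⇒≡ : intervalClique a b x y ≡ true → x ≡ y
  bothInRange⇒≡ eq with Equivalence.to T-∧ (subst T (≡.sym eq) tt)
  ... | tx , ty with inRange⇒bounds tx | inRange⇒bounds ty
  ...   | a≤x , x≤b | a≤y , y≤b = toℕ-injective (≤-antisym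
          (≤-trans x≤b (≤-trans b≤a a≤y)) (≤-trans y≤b (≤-trans b≤a a≤x)))

firstTwoParity : ∀ {n} → (Fin n → Bool) → Bool
firstTwoParity {zero}        r = false
firstTwoParity {suc zero}    r = r fz
firstTwoParity {suc (suc n)} r = r fz xor r (fs fz)

firstTwoParity-cong : ∀ {n} {r r′ : Fin n → Bool} → (∀ i → r i ≡ r′ i) →
  firstTwoParity r ≡ firstTwoParity r′
firstTwoParity-cong {zero}        eq = refl
firstTwoParity-cong {suc zero}    eq = eq fz
firstTwoParity-cong {suc (suc n)} eq = cong₂ _xor_ (eq fz) (eq (fs fz))

firstTwoParity-xor : ∀ {n} (r r′ : Fin n → Bool) →
  firstTwoParity (λ i → r i xor r′ i) ≡ firstTwoParity r xor firstTwoParity r′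
firstTwoParity-xor {zero}        r r′ = refl
firstTwoParity-xor {suc zero}    r r′ = refl
firstTwoParity-xor {suc (suc n)} r r′ =
  xor-interchange (r fz) (r′ fz) (r (fs fz)) (r′ (fs fz))

firstTwoParity-false : ∀ {n} → firstTwoParity {n} (λ _ → false) ≡ false
firstTwoParity-false {zero}        = refl
firstTwoParity-false {suc zero}    = refl
firstTwoParity-false {suc (suc n)} = refl

-- The parity of the number of edges {x, x+1} and {x, x+2}; vertex 0 contributes
-- its adjacencies to vertices 1 and 2.
dropVertex0 : ∀ {n} → (Fin (suc n) → Fin (suc n) → Bool) → Fin n → Fin n → Bool
dropVertex0 d i j = d (fs i) (fs j)

shortEdgeParity : ∀ {n} → (Fin n → Fin n → Bool) → Bool
shortEdgeParity {zero}  d = false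
shortEdgeParity {suc n} d = shortEdgeParity (dropVertex0 d) xor firstTwoParity (d fz ∘ fs)

shortEdgeParity-cong : ∀ {n} {d d′ : Fin n → Fin n → Bool} →
  (∀ x y → x ≢ y → d x y ≡ d′ x y) → shortEdgeParity d ≡ shortEdgeParity d′
shortEdgeParity-cong {zero}  eq = refl
shortEdgeParity-cong {suc n} eq = cong₂ _xor_
  (shortEdgeParity-cong λ x y x≢y → eq (fs x) (fs y) (x≢y ∘ suc-injective))
  (firstTwoParity-cong λ i → eq fz (fs i) λ ())

shortEdgeParity-xor : ∀ {n} (d d′ : Fin n → Fin n → Bool) →
  shortEdgeParity (λ x y → d x y xor d′ x y) ≡ shortEdgeParity d xor shortEdgeParity d′
shortEdgeParity-xor {zero}  d d′ = refl
shortEdgeParity-xor {suc n} d d′ = trans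
  (cong₂ _xor_ (shortEdgeParity-xor (dropVertex0 d) (dropVertex0 d′))
               (firstTwoParity-xor (d fz ∘ fs) (d′ fz ∘ fs)))
  (xor-interchange (shortEdgeParity (dropVertex0 d)) (shortEdgeParity (dropVertex0 d′))
                   (firstTwoParity (d fz ∘ fs)) (firstTwoParity (d′ fz ∘ fs)))

shortEdgeParity-false : ∀ {n} → shortEdgeParity {n} (λ _ _ → false) ≡ false
shortEdgeParity-false {zero}  = refl
shortEdgeParity-false {suc n} = cong₂ _xor_ (shortEdgeParity-false {n}) (firstTwoParity-false {n})

firstTwoParity-<ᵇ : ∀ {n b} → b < n →
  firstTwoParity {n} (λ j → toℕ j <ᵇ suc b) ≡ true xor (0 <ᵇ b)
firstTwoParity-<ᵇ {suc zero}    {zero}  _               = refl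
firstTwoParity-<ᵇ {suc zero}    {suc b} (s≤s ())
firstTwoParity-<ᵇ {suc (suc n)}         _               = refl

shortEdgeParity-intervalClique-suc : ∀ {n} a b →
  shortEdgeParity (dropVertex0 (intervalClique {suc n} a (suc b))) ≡
  shortEdgeParity (intervalClique {n} (pred a) b)
shortEdgeParity-intervalClique-suc {n} a b =
  shortEdgeParity-cong {n} λ x y _ → intervalClique-suc a b x y

shortEdgeParity-intervalClique : ∀ {n a b} → a ≤ b → b < n →
  shortEdgeParity (intervalClique {n} a b) ≡ (a <ᵇ b)
shortEdgeParity-intervalClique {suc n} {zero} {zero} _ _ =
  cong₂ _xor_ (shortEdgeParity-false {n}) (firstTwoParity-false {n})
shortEdgeParity-intervalClique {suc n} {zero} {suc b} _ (s≤s b<n) = begin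
  shortEdgeParity (dropVertex0 (intervalClique {suc n} 0 (suc b)))
    xor firstTwoParity {n} (λ j → toℕ j <ᵇ suc b)
    ≡⟨ cong₂ _xor_ (trans (shortEdgeParity-intervalClique-suc {n} 0 b)
                          (shortEdgeParity-intervalClique {n} z≤n b<n))
                   (firstTwoParity-<ᵇ {n} b<n) ⟩
  (0 <ᵇ b) xor (true xor (0 <ᵇ b))
    ≡⟨ x∙yz≈y∙xz (0 <ᵇ b) true (0 <ᵇ b) ⟩
  true xor ((0 <ᵇ b) xor (0 <ᵇ b))
    ≡⟨ cong (true xor_) (xor-same (0 <ᵇ b)) ⟩
  true ∎
  where open ≡-Reasoning
shortEdgeParity-intervalClique {suc n} {suc a} {suc b} (s≤s a≤b) (s≤s b<n) = begin
  shortEdgeParity (dropVertex0 (intervalClique {suc n} (suc a) (suc b)))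
    xor firstTwoParity {n} (λ _ → false)
    ≡⟨ cong₂ _xor_ (trans (shortEdgeParity-intervalClique-suc {n} (suc a) b)
                          (shortEdgeParity-intervalClique {n} a≤b b<n))
                   (firstTwoParity-false {n}) ⟩
  (a <ᵇ b) xor false
    ≡⟨ xor-identityʳ (a <ᵇ b) ⟩
  a <ᵇ b ∎
  where open ≡-Reasoning

sameParity⇒¬SymDiffIsIntervalClique : ∀ {n} (G₁ G₂ : Graph n) →
  shortEdgeParity (adj G₁) ≡ shortEdgeParity (adj G₂) →
  Distinct G₁ G₂ → ¬ SymDiffIsIntervalClique G₁ G₂
sameParity⇒¬SymDiffIsIntervalClique {n} G₁ G₂ sameParity
  (i , j , differ) (a , b , a≤b , symDiff) = differ adj-equal
  where
  open ≡-Reasoning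
  a≮b : (toℕ a <ᵇ toℕ b) ≡ false
  a≮b = begin
    toℕ a <ᵇ toℕ b
      ≡⟨ shortEdgeParity-intervalClique a≤b (toℕ<n b) ⟨
    shortEdgeParity (intervalClique {n} (toℕ a) (toℕ b))
      ≡⟨ shortEdgeParity-cong symDiff ⟨
    shortEdgeParity (λ x y → adj G₁ x y xor adj G₂ x y)
      ≡⟨ shortEdgeParity-xor (adj G₁) (adj G₂) ⟩
    shortEdgeParity (adj G₁) xor shortEdgeParity (adj G₂)
      ≡⟨ cong (_xor shortEdgeParity (adj G₂)) sameParity ⟩
    shortEdgeParity (adj G₂) xor shortEdgeParity (adj G₂)
      ≡⟨ xor-same (shortEdgeParity (adj G₂)) ⟩
    false ∎

  b≤a : toℕ b ≤ toℕ a
  b≤a = ≮⇒≥ λ a<b → subst T a≮b (<⇒<ᵇ a<b)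

  adj-equal : adj G₁ i j ≡ adj G₂ i j
  adj-equal with i ≟ᶠ j
  ... | yes refl = trans (irrefl G₁ i) (≡.sym (irrefl G₂ i))
  ... | no i≢j   =
    xor≡false⇒≡ (trans (symDiff i j i≢j) (intervalClique-edgeless b≤a i≢j))

-- A code for n + 1 vertices is a code for the vertices 1, …, n together with the
-- neighbourhood of vertex 0 among them.
Code : ℕ → Set
Code zero    = ⊤
Code (suc n) = Code n × Vec Bool n

codeAdj : ∀ {n} → Code n → Fin n → Fin n → Bool
codeAdj {suc n} (c , v) fz     fz     = false
codeAdj {suc n} (c , v) fz     (fs j) = lookup v j
codeAdj {suc n} (c , v) (fs i) fz     = lookup v i
codeAdj {suc n} (c , v) (fs i) (fs j) = codeAdj c i j

codeAdj-sym : ∀ {n} (c : Code n) i j → codeAdj c i j ≡ codeAdj c j i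
codeAdj-sym {suc n} (c , v) fz     fz     = refl
codeAdj-sym {suc n} (c , v) fz     (fs j) = refl
codeAdj-sym {suc n} (c , v) (fs i) fz     = refl
codeAdj-sym {suc n} (c , v) (fs i) (fs j) = codeAdj-sym c i j

codeAdj-irrefl : ∀ {n} (c : Code n) i → codeAdj c i i ≡ false
codeAdj-irrefl {suc n} (c , v) fz     = refl
codeAdj-irrefl {suc n} (c , v) (fs i) = codeAdj-irrefl c i

toGraph : ∀ {n} → Code n → Graph n
toGraph c = record { adj = codeAdj c ; sym = codeAdj-sym c ; irrefl = codeAdj-irrefl c }

codeAdj-injective : ∀ {n} {c c′ : Code n} →
  (∀ i j → codeAdj c i j ≡ codeAdj c′ i j) → c ≡ c′
codeAdj-injective {zero}                    _  = refl
codeAdj-injective {suc n} {c , v} {c′ , v′} eq =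
  cong₂ _,_ (codeAdj-injective λ i j → eq (fs i) (fs j)) lookup-ext
  where
  lookup-ext : v ≡ v′
  lookup-ext = trans (≡.sym (tabulate∘lookup v))
                     (trans (tabulate-cong λ j → eq fz (fs j)) (tabulate∘lookup v′))

¬adj≗⇒Distinct : ∀ {n} (G₁ G₂ : Graph n) →
  ¬ (∀ i j → adj G₁ i j ≡ adj G₂ i j) → Distinct G₁ G₂
¬adj≗⇒Distinct {n} G₁ G₂ ¬adj≗
  with ¬∀⟶∃¬ n _ (λ i → all? λ j → adj G₁ i j ≟ᵇ adj G₂ i j) ¬adj≗
... | i , ¬row≗ with ¬∀⟶∃¬ n _ (λ j → adj G₁ i j ≟ᵇ adj G₂ i j) ¬row≗
...   | j , differ = i , j , differ

-- The adjacency of vertices 0 and 1 is chosen to make the short-edge parity even.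
evenExtension : ∀ {m} → Code (suc m) × Vec Bool m → Code (suc (suc m))
evenExtension (c , [])        = c , (shortEdgeParity (codeAdj c) ∷ [])
evenExtension (c , w@(x ∷ _)) = c , ((shortEdgeParity (codeAdj c) xor x) ∷ w)

shortEdgeParity-evenExtension : ∀ {m} (cw : Code (suc m) × Vec Bool m) →
  shortEdgeParity (codeAdj (evenExtension cw)) ≡ false
shortEdgeParity-evenExtension (c , [])     = xor-same (shortEdgeParity (codeAdj c))
shortEdgeParity-evenExtension (c , x ∷ _) = cancel (shortEdgeParity (codeAdj c)) x
  where
  cancel : ∀ p x → p xor ((p xor x) xor x) ≡ false
  cancel false x = xor-same x
  cancel true  false = refl
  cancel true  true  = refl

evenExtension-injective : ∀ {m} {cw cw′ : Code (suc m) × Vec Bool m} →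
  evenExtension cw ≡ evenExtension cw′ → cw ≡ cw′
evenExtension-injective {cw = c , []}    {.c , []}    refl = refl
evenExtension-injective {cw = c , _ ∷ _} {.c , _ ∷ _} refl = refl

evenExtension-separated : ∀ {m} {cw cw′ : Code (suc m) × Vec Bool m} → cw ≢ cw′ →
  let G₁ = toGraph (evenExtension cw) ; G₂ = toGraph (evenExtension cw′) in
  Distinct G₁ G₂ × ¬ SymDiffIsIntervalClique G₁ G₂
evenExtension-separated {m} {cw} {cw′} cw≢cw′ =
  distinct , sameParity⇒¬SymDiffIsIntervalClique G₁ G₂ sameParity distinct
  where
  G₁ G₂ : Graph (suc (suc m))
  G₁ = toGraph (evenExtension cw)
  G₂ = toGraph (evenExtension cw′)

  distinct : Distinct G₁ G₂
  distinct =
    ¬adj≗⇒Distinct G₁ G₂ (cw≢cw′ ∘ evenExtension-injective ∘ codeAdj-injective)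

  sameParity : shortEdgeParity (adj G₁) ≡ shortEdgeParity (adj G₂)
  sameParity = trans (shortEdgeParity-evenExtension cw)
                     (≡.sym (shortEdgeParity-evenExtension cw′))

length-cartesianProductWith : ∀ {A B C : Set} (f : A → B → C) xs ys →
  length (cartesianProductWith f xs ys) ≡ length xs * length ys
length-cartesianProductWith f []       ys = refl
length-cartesianProductWith f (x ∷ xs) ys = begin
  length (map (f x) ys ++ cartesianProductWith f xs ys)
    ≡⟨ length-++ (map (f x) ys) ⟩
  length (map (f x) ys) + length (cartesianProductWith f xs ys)
    ≡⟨ cong₂ _+_ (length-map (f x) ys) (length-cartesianProductWith f xs ys) ⟩
  length ys + length xs * length ys ∎
  where open ≡-Reasoning

allBoolVecs : ∀ n → List (Vec Bool n)
allBoolVecs zero    = [] ∷ []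
allBoolVecs (suc n) = cartesianProductWith _∷_ (true ∷ false ∷ []) (allBoolVecs n)

allCodes : ∀ n → List (Code n)
allCodes zero    = tt ∷ []
allCodes (suc n) = cartesianProduct (allCodes n) (allBoolVecs n)

allBoolVecs-unique : ∀ n → Unique (allBoolVecs n)
allBoolVecs-unique zero    = [] ∷ []
allBoolVecs-unique (suc n) =
  Unique.cartesianProductWith⁺ _∷_ ∷-injective
    (((λ ()) ∷ []) ∷ [] ∷ []) (allBoolVecs-unique n)

allCodes-unique : ∀ n → Unique (allCodes n)
allCodes-unique zero    = [] ∷ []
allCodes-unique (suc n) = Unique.cartesianProduct⁺ (allCodes-unique n) (allBoolVecs-unique n)

length-allBoolVecs : ∀ n → length (allBoolVecs n) ≡ 2 ^ n
length-allBoolVecs zero    = refl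
length-allBoolVecs (suc n) =
  trans (length-cartesianProductWith _∷_ (true ∷ false ∷ []) (allBoolVecs n))
        (cong (2 *_) (length-allBoolVecs n))

[1+n]C2≡n+nC2 : ∀ n → suc n C 2 ≡ n + n C 2
[1+n]C2≡n+nC2 n = trans (≡.sym (nCk+nC[k+1]≡[n+1]C[k+1] n 1)) (cong (_+ n C 2) (nC1≡n n))

length-allCodes : ∀ n → length (allCodes n) ≡ 2 ^ (n C 2)
length-allCodes zero    = refl
length-allCodes (suc n) = begin
  length (cartesianProduct (allCodes n) (allBoolVecs n))
    ≡⟨ length-cartesianProductWith _,_ (allCodes n) (allBoolVecs n) ⟩
  length (allCodes n) * length (allBoolVecs n)
    ≡⟨ cong₂ _*_ (length-allCodes n) (length-allBoolVecs n) ⟩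
  2 ^ (n C 2) * 2 ^ n
    ≡⟨ *-comm (2 ^ (n C 2)) (2 ^ n) ⟩
  2 ^ n * 2 ^ (n C 2)
    ≡⟨ ^-distribˡ-+-* 2 n (n C 2) ⟨
  2 ^ (n + n C 2)
    ≡⟨ cong (2 ^_) ([1+n]C2≡n+nC2 n) ⟨
  2 ^ (suc n C 2) ∎
  where open ≡-Reasoning

length-extensions : ∀ m →
  2 ^ (suc (suc m) C 2) ≡ 2 * length (cartesianProduct (allCodes (suc m)) (allBoolVecs m))
length-extensions m = begin
  2 ^ (suc (suc m) C 2)
    ≡⟨ cong (2 ^_) ([1+n]C2≡n+nC2 (suc m)) ⟩
  2 ^ (suc m + suc m C 2)
    ≡⟨ ^-distribˡ-+-* 2 (suc m) (suc m C 2) ⟩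
  2 * 2 ^ m * 2 ^ (suc m C 2)
    ≡⟨ *-assoc 2 (2 ^ m) (2 ^ (suc m C 2)) ⟩
  2 * (2 ^ m * 2 ^ (suc m C 2))
    ≡⟨ cong (2 *_) (*-comm (2 ^ m) (2 ^ (suc m C 2))) ⟩
  2 * (2 ^ (suc m C 2) * 2 ^ m)
    ≡⟨ cong (2 *_) (cong₂ _*_ (length-allCodes (suc m)) (length-allBoolVecs m)) ⟨
  2 * (length (allCodes (suc m)) * length (allBoolVecs m))
    ≡⟨ cong (2 *_) (length-cartesianProductWith _,_ (allCodes (suc m)) (allBoolVecs m)) ⟨
  2 * length (cartesianProduct (allCodes (suc m)) (allBoolVecs m)) ∎
  where open ≡-Reasoning

theorem2p2 : (n : ℕ) → 2 ≤ n →
    Σ (List (Graph n)) (λ 𝒢 →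
      AllPairs (λ G₁ G₂ → Distinct G₁ G₂ × ¬ SymDiffIsIntervalClique G₁ G₂) 𝒢
      × 2 ^ (n C 2) ≤ 2 * length 𝒢)
theorem2p2 (suc (suc m)) (s≤s (s≤s _)) =
  map (toGraph ∘ evenExtension) extensions ,
  AllPairs.map⁺ (AllPairs.map evenExtension-separated
    (Unique.cartesianProduct⁺ (allCodes-unique (suc m)) (allBoolVecs-unique m))) ,
  ≤-reflexive (trans (length-extensions m)
                     (cong (2 *_) (≡.sym (length-map (toGraph ∘ evenExtension) extensions))))
  where
  extensions : List (Code (suc m) × Vec Bool m)
  extensions = cartesianProduct (allCodes (suc m)) (allBoolVecs m)
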